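{- Let $\mathcal{S}=(S,\{0,1\}^X)$ be a system and let $Q$ be a finite sequence of operators from $\{\mathrm{Int}_{\{x\}},\mathrm{Un}_{\{x\}}: x\in X\}$ such that $Q(\mathcal{S})$ is defined. Let $\overline{Q}$ be a permutation of $Q$ in which all the operators of the form $\mathrm{Un}_{\{x\}}$ appear before all the operators of the form $\mathrm{Int}_{\{x\}}$, and let $\underline{Q}$ be a permutation of $Q$ in which all the operators of the form $\mathrm{Int}_{\{x\}}$ appear before all operators of the form $\mathrm{Un}_{\{x\}}$. Then $S(\underline{Q}(\mathcal{S}))\subseteq S(Q(\mathcal{S}))\subseteq S(\overline{Q}(\mathcal{S}))$.
   Context: A system is $\mathcal{S}=(S,\{0,1\}^X)$ with $X$ finite and $S\subseteq\{0,1\}^X$; $S(\mathcal{S})$ denotes its set. For disjoint $A,B$, $f\in\{0,1\}^A,g\in\{0,1\}^B$, $g\star f$ is the common extension. For a set $Y$, $\mathrm{Int}_Y$ and $\mathrm{Un}_Y$ are defined only on systems $\mathcal{S}=(S,\{0,1\}^X)$ with $Y\subseteq X$, by $\mathrm{Int}_Y(\mathcal{S})=(\{g\in\{0,1\}^{X\setminus Y}:\forall f\in\{0,1\}^Y, g\star f\in S\},\{0,1\}^{X\setminus Y})$ and $\mathrm{Un}_Y(\mathcal{S})=(\{g\in\{0,1\}^{X\setminus Y}:\exists f\in\{0,1\}^Y, g\star f\in S\},\{0,1\}^{X\setminus Y})$. $Q(\mathcal{S})$ denotes the result of applying the operators of $Q$ one after the other (first element first). -}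

module Defs where

open import Data.Nat using (ℕ)
open import Data.Unit using (⊤)
open import Data.Empty using (⊥)
open import Data.Bool using (Bool; true; false)
open import Data.Fin using (Fin)
open import Data.Vec using (Vec; _[_]≔_; lookup; replicate)
open import Data.Product using (∃; _×_)
open import Data.List using (List; []; _∷_; _++_)
open import Data.List.Relation.Unary.All using (All)
open import Data.List.Relation.Binary.Permutation.Propositional using (_↭_)
open import Relation.Binary.PropositionalEquality using (_≡_)

-- Convention: the variable set X of the system is identified with Fin n
-- (n = |X|).
-- An assignment of a sub-domain X∖Y is represented by a full vector
-- whose coordinates in Y are irrelevant (the set of a derived system
-- never depends on the removed coordinates).
Assignment : ℕ → Set
Assignment n = Vec Bool n

SysSet : ℕ → Set₁
SysSet n = Assignment n → Set

data Op (n : ℕ) : Set where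
  Int Un : Fin n → Op n

var : ∀ {n} → Op n → Fin n
var (Int x) = x
var (Un x) = x

IsInt IsUn : ∀ {n} → Op n → Set
IsInt (Int _) = ⊤
IsInt (Un _) = ⊥
IsUn (Int _) = ⊥
IsUn (Un _) = ⊤

applyOp : ∀ {n} → Op n → SysSet n → SysSet n
applyOp (Int x) S g = (b : Bool) → S (g [ x ]≔ b)
applyOp (Un x)  S g = ∃ λ (b : Bool) → S (g [ x ]≔ b)

run : ∀ {n} → List (Op n) → SysSet n → SysSet n
run [] S = S
run (o ∷ Q) S = run Q (applyOp o S)

-- Current domain of a system as a subset of X = Fin n (true = present).
Domain : ℕ → Set
Domain n = Vec Bool n

Defined : ∀ {n} → Domain n → List (Op n) → Set
Defined D [] = ⊤
Defined D (o ∷ Q) = (lookup D (var o) ≡ true) × Defined (D [ var o ]≔ false) Q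

fullDomain : ∀ n → Domain n
fullDomain n = replicate n true

UnsFirst : ∀ {n} → List (Op n) → List (Op n) → Set
UnsFirst Q Q̄ = (Q̄ ↭ Q) × ∃ λ U → ∃ λ I → (Q̄ ≡ U ++ I) × All IsUn U × All IsInt I

IntsFirst : ∀ {n} → List (Op n) → List (Op n) → Set
IntsFirst Q Q̲ = (Q̲ ↭ Q) × ∃ λ I → ∃ λ U → (Q̲ ≡ I ++ U) × All IsInt I × All IsUn U

-- For distinct variables x ≠ y, Un_{y}(Int_{x}(S)) ⊆ Int_{x}(Un_{y}(S)) (the
-- ∃∀ ⊆ ∀∃ exchange), while two operators of the same kind commute.  Since Q(S)
-- is defined, the variables of Q are distinct, so moving a Un one step earlier
-- past an Int can only enlarge the result.  Q̄ is reached from Q, and Q from Q̲,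
-- by such moves; an insertion-sort induction along Q makes this precise.
module Submission where

open import Defs
open import Data.Nat using (ℕ)
open import Data.Bool using (true; false)
open import Data.List using (List; []; _∷_; _++_)
open import Data.List.Relation.Unary.All as All using (All; []; _∷_)
open import Data.List.Relation.Unary.All.Properties using (++⁻ˡ; ++⁻ʳ; ++⁺)
open import Data.List.Relation.Unary.AllPairs using (AllPairs; []; _∷_)
open import Data.List.Relation.Unary.Any using (here)
open import Data.List.Membership.Propositional.Properties using (∈-∃++)
open import Data.List.Relation.Binary.Permutation.Propositional using (_↭_; ↭-sym)
open import Data.List.Relation.Binary.Permutation.Propositional.Properties
  using (∈-resp-↭; All-resp-↭; drop-mid; ↭-empty-inv)
open import Data.Product using (_×_; _,_; ∃₂)
open import Data.Vec using (_[_]≔_; lookup)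
open import Data.Vec.Properties using ([]≔-commutes; lookup∘update; lookup∘update′)
open import Function using (_on_; flip)
open import Relation.Binary.PropositionalEquality using (_≡_; _≢_; refl; sym; trans; subst; ≢-sym)

private
  variable
    n : ℕ

infix 4 _⊆ₛ_ _⊑_ _⊴_

_⊆ₛ_ : SysSet n → SysSet n → Set
S ⊆ₛ T = ∀ g → S g → T g

record _⊑_ (Q Q′ : List (Op n)) : Set₁ where
  constructor run-⊆
  field run-⊆-run : ∀ S → run Q S ⊆ₛ run Q′ S
open _⊑_

-- Swapping adjacent a ⊴ b into b, a only enlarges (swap-⊑); Q̲ is ⊴-sorted and Q̄
-- sorted in reverse.
_⊴_ : Op n → Op n → Set
a ⊴ b = IsUn a → IsUn b

Int-⊴ : {a b : Op n} → IsInt a → a ⊴ b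
Int-⊴ {a = Int x} _ ()

⊴-Un : {a b : Op n} → IsUn b → a ⊴ b
⊴-Un u _ = u

Distinct : List (Op n) → Set
Distinct = AllPairs (_≢_ on var)

⊑-refl : {Q : List (Op n)} → Q ⊑ Q
⊑-refl = run-⊆ λ S g h → h

⊑-trans : {Q Q′ Q″ : List (Op n)} → Q ⊑ Q′ → Q′ ⊑ Q″ → Q ⊑ Q″
⊑-trans Q⊑Q′ Q′⊑Q″ = run-⊆ λ S g h → run-⊆-run Q′⊑Q″ S g (run-⊆-run Q⊑Q′ S g h)

∷-mono-⊑ : {o : Op n} {Q Q′ : List (Op n)} → Q ⊑ Q′ → o ∷ Q ⊑ o ∷ Q′
∷-mono-⊑ {o = o} Q⊑Q′ = run-⊆ λ S → run-⊆-run Q⊑Q′ (applyOp o S)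

applyOp-mono : ∀ (o : Op n) {S T} → S ⊆ₛ T → applyOp o S ⊆ₛ applyOp o T
applyOp-mono (Int x) S⊆T g h b = S⊆T _ (h b)
applyOp-mono (Un x) S⊆T g (b , h) = b , S⊆T _ h

run-mono : ∀ (Q : List (Op n)) {S T} → S ⊆ₛ T → run Q S ⊆ₛ run Q T
run-mono [] S⊆T = S⊆T
run-mono (o ∷ Q) S⊆T = run-mono Q (applyOp-mono o S⊆T)

applyOp-swap : ∀ (a b : Op n) {S} → var a ≢ var b → a ⊴ b →
               applyOp b (applyOp a S) ⊆ₛ applyOp a (applyOp b S)
applyOp-swap (Int x) (Int z) {S} x≢z _ g h d c = subst S ([]≔-commutes g z x (≢-sym x≢z)) (h c d)
applyOp-swap (Int x) (Un z) {S} x≢z _ g (c , h) d = c , subst S ([]≔-commutes g z x (≢-sym x≢z)) (h d)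
applyOp-swap (Un y) (Un z) {S} y≢z _ g (c , d , h) = d , c , subst S ([]≔-commutes g z y (≢-sym y≢z)) h
applyOp-swap (Un y) (Int z) _ Un⊴Int with () ← Un⊴Int _

swap-⊑ : ∀ {a b : Op n} {R} → var a ≢ var b → a ⊴ b → a ∷ b ∷ R ⊑ b ∷ a ∷ R
swap-⊑ {a = a} {b} {R} a≢b a⊴b = run-⊆ λ S → run-mono R (applyOp-swap a b a≢b a⊴b)

⊑-moveʳ : ∀ {o : Op n} L {R} → All (λ p → var o ≢ var p × o ⊴ p) L → o ∷ L ++ R ⊑ L ++ o ∷ R
⊑-moveʳ []      []              = ⊑-refl
⊑-moveʳ (p ∷ L) ((o≢p , ⊴p) ∷ ok) = ⊑-trans (swap-⊑ o≢p ⊴p) (∷-mono-⊑ (⊑-moveʳ L ok))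

⊑-moveˡ : ∀ {o : Op n} L {R} → All (λ p → var o ≢ var p × p ⊴ o) L → L ++ o ∷ R ⊑ o ∷ L ++ R
⊑-moveˡ []      []              = ⊑-refl
⊑-moveˡ (p ∷ L) ((o≢p , ⊴p) ∷ ok) = ⊑-trans (∷-mono-⊑ (⊑-moveˡ L ok)) (swap-⊑ (≢-sym o≢p) ⊴p)

module _ {A : Set} where

  ↭-∷-split : ∀ {xs ys : List A} {x} → xs ↭ x ∷ ys →
              ∃₂ λ L R → xs ≡ L ++ x ∷ R × L ++ R ↭ ys
  ↭-∷-split xs↭x∷ys with L , R , refl ← ∈-∃++ (∈-resp-↭ (↭-sym xs↭x∷ys) (here refl)) =
    L , R , refl , drop-mid L [] xs↭x∷ys

  AllPairs-drop-mid : ∀ {ℓ} {_∼_ : A → A → Set ℓ} L {x R} → AllPairs _∼_ (L ++ x ∷ R) →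
                      All (_∼ x) L × AllPairs _∼_ (L ++ R)
  AllPairs-drop-mid []      (_ ∷ ∼R) = [] , ∼R
  AllPairs-drop-mid (p ∷ L) (p∼ ∷ ∼) with p∼x ∷ p∼R ← ++⁻ʳ L p∼ | ∼x , ∼LR ← AllPairs-drop-mid L ∼ =
    p∼x ∷ ∼x , ++⁺ (++⁻ˡ L p∼) p∼R ∷ ∼LR

  AllPairs-++⁺-blocks : ∀ {ℓ} {_∼_ : A → A → Set ℓ} {P P′ : A → Set} →
                        (∀ {a b} → P a → a ∼ b) → (∀ {a b} → P′ b → a ∼ b) →
                        ∀ {xs ys} → All P xs → All P′ ys → AllPairs _∼_ (xs ++ ys)
  AllPairs-++⁺-blocks P∼ ∼P′ (Pa ∷ Pxs) P′ys = All.tabulate (λ _ → P∼ Pa) ∷ AllPairs-++⁺-blocks P∼ ∼P′ Pxs P′ys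
  AllPairs-++⁺-blocks P∼ ∼P′ []         []          = []
  AllPairs-++⁺-blocks P∼ ∼P′ []         (_ ∷ P′ys)  = All.map ∼P′ P′ys ∷ AllPairs-++⁺-blocks P∼ ∼P′ [] P′ys

lookup-[]≔false⇒≢ : ∀ {D : Domain n} {i j} → lookup (D [ i ]≔ false) j ≡ true → i ≢ j
lookup-[]≔false⇒≢ {D = D} {i} D′ᵢ≡true refl with () ← trans (sym (lookup∘update i D false)) D′ᵢ≡true

Defined⇒vars-in-domain : ∀ {D : Domain n} {Q} → Defined D Q → All (λ o → lookup D (var o) ≡ true) Q
Defined⇒vars-in-domain {Q = []}    _           = []
Defined⇒vars-in-domain {D = D} {o ∷ Q} (Dₒ , defined) = Dₒ ∷ All.map restore (Defined⇒vars-in-domain defined)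
  where
  restore : ∀ {j} → lookup (D [ var o ]≔ false) j ≡ true → lookup D j ≡ true
  restore D′ⱼ = trans (sym (lookup∘update′ (≢-sym (lookup-[]≔false⇒≢ {D = D} D′ⱼ)) D false)) D′ⱼ

Defined⇒Distinct : ∀ {D : Domain n} {Q} → Defined D Q → Distinct Q
Defined⇒Distinct {Q = []}    _            = []
Defined⇒Distinct {D = D} {o ∷ Q} (_ , defined) =
  All.map (lookup-[]≔false⇒≢ {D = D}) (Defined⇒vars-in-domain defined) ∷ Defined⇒Distinct defined

⊑-descending : ∀ {Q Q′ : List (Op n)} → Distinct Q → Q′ ↭ Q → AllPairs (flip _⊴_) Q′ → Q ⊑ Q′
⊑-descending {Q = []} _ Q′↭[] _ with refl ← ↭-empty-inv Q′↭[] = ⊑-refl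
⊑-descending {Q = o ∷ Q} (o-fresh ∷ distinct) Q′↭o∷Q sorted
  with L , R , refl , L++R↭Q ← ↭-∷-split Q′↭o∷Q
  with L⊵o , sorted′ ← AllPairs-drop-mid L sorted =
  ⊑-trans (∷-mono-⊑ (⊑-descending distinct L++R↭Q sorted′))
          (⊑-moveʳ L (All.zip (++⁻ˡ L (All-resp-↭ (↭-sym L++R↭Q) o-fresh) , L⊵o)))

⊑-ascending : ∀ {Q Q′ : List (Op n)} → Distinct Q → Q′ ↭ Q → AllPairs _⊴_ Q′ → Q′ ⊑ Q
⊑-ascending {Q = []} _ Q′↭[] _ with refl ← ↭-empty-inv Q′↭[] = ⊑-refl
⊑-ascending {Q = o ∷ Q} (o-fresh ∷ distinct) Q′↭o∷Q sorted
  with L , R , refl , L++R↭Q ← ↭-∷-split Q′↭o∷Q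
  with L⊴o , sorted′ ← AllPairs-drop-mid L sorted =
  ⊑-trans (⊑-moveˡ L (All.zip (++⁻ˡ L (All-resp-↭ (↭-sym L++R↭Q) o-fresh) , L⊴o)))
          (∷-mono-⊑ (⊑-ascending distinct L++R↭Q sorted′))

mainTheorem20 : (n : ℕ) (S : SysSet n) (Q Qlow Qhigh : List (Op n))
    → Defined (fullDomain n) Q
    → UnsFirst Q Qhigh
    → IntsFirst Q Qlow
    → ((g : Assignment n) → run Qlow S g → run Q S g)
    × ((g : Assignment n) → run Q S g → run Qhigh S g)
mainTheorem20 n S Q Qlow Qhigh defined (Qhigh↭Q , _ , _ , refl , Us , Is) (Qlow↭Q , _ , _ , refl , Is′ , Us′) =
  run-⊆-run (⊑-ascending distinct Qlow↭Q (AllPairs-++⁺-blocks Int-⊴ ⊴-Un Is′ Us′)) S ,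
  run-⊆-run (⊑-descending distinct Qhigh↭Q (AllPairs-++⁺-blocks ⊴-Un Int-⊴ Us Is)) S
  where
  distinct : Distinct Q
  distinct = Defined⇒Distinct defined
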